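{- Let $k \ge 2$ be an integer and let $D$ be a $k$-quasi-transitive digraph. If $u$ is a $(k+1)$-king of $D$, then every vertex $v \in V(D)$ with $d(u,v) = k+1$ is also a $(k+1)$-king of $D$.
   Context: All digraphs are finite, without loops and without multiple arcs in the same direction; paths are directed. For $u,v \in V(D)$, $d(u,v)$ is the length of a shortest directed $uv$-path ($\infty$ if none, $d(v,v)=0$). A vertex $v$ is an $r$-king of $D$ if $d(v,u) \le r$ for every $u \in V(D)$. $D$ is $k$-quasi-transitive if for every directed path $(v_0, \dots, v_k)$ of length $k$, $(v_0,v_k) \in A(D)$ or $(v_k,v_0) \in A(D)$. -}

module Defs where

open import Data.Nat using (ℕ; zero; suc; _≤_)
open import Data.Fin using (Fin; inject₁; fromℕ; toℕ) renaming (suc to fsuc; zero to fzero)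
open import Data.Product using (Σ; _×_; _,_; ∃)
open import Data.Sum using (_⊎_)
open import Data.Empty using (⊥)
open import Relation.Nullary using (¬_)
open import Relation.Binary.PropositionalEquality using (_≡_)
open import Function.Definitions using (Injective)

record Digraph : Set₁ where
  field
    n     : ℕ
    Arc   : Fin n → Fin n → Set
    loopless : ∀ v → ¬ Arc v v

open Digraph public

Vertex : Digraph → Set
Vertex D = Fin (n D)

record Path (D : Digraph) (ℓ : ℕ) : Set where
  field
    vert     : Fin (suc ℓ) → Vertex D
    distinct : Injective _≡_ _≡_ vert
    arcs     : ∀ (i : Fin ℓ) → Arc D (vert (inject₁ i)) (vert (fsuc i))

open Path public

start : ∀ {D ℓ} → Path D ℓ → Vertex D
start p = vert p fzero

end : ∀ {D ℓ} → Path D ℓ → Vertex D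
end {ℓ = ℓ} p = vert p (fromℕ ℓ)

PathOfLength : (D : Digraph) → Vertex D → Vertex D → ℕ → Set
PathOfLength D u v ℓ = Σ (Path D ℓ) λ p → (start p ≡ u) × (end p ≡ v)

DistLe : (D : Digraph) → Vertex D → Vertex D → ℕ → Set
DistLe D u v r = Σ ℕ λ ℓ → (ℓ ≤ r) × PathOfLength D u v ℓ

DistEq : (D : Digraph) → Vertex D → Vertex D → ℕ → Set
DistEq D u v m = PathOfLength D u v m × (∀ ℓ → PathOfLength D u v ℓ → m ≤ ℓ)

IsKing : (D : Digraph) → ℕ → Vertex D → Set
IsKing D r v = ∀ u → DistLe D v u r

QuasiTransitive : ℕ → Digraph → Set
QuasiTransitive k D = ∀ (p : Path D k) → Arc D (start p) (end p) ⊎ Arc D (end p) (start p)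

-- Let u x₁ … x_k v be a shortest uv-path. Quasi-transitivity applied to its two subpaths
-- of length k, together with d(u,v) = k+1 > 2, forces the arcs v → x₁ and x_k → u, so v
-- reaches u within k+1 steps and hence reaches every vertex. It remains to see that the
-- vertices within distance k+1 of v are closed under out-arcs, i.e. that d(v,w) ≤ k+1
-- whenever there is a path v r₁ … r_{k+1} w. Quasi-transitivity on r₂ … w, on v … r_k
-- and on w r₂ … r_k v leaves only the case of an arc w → v; such a w is handled by
-- looking at a path of length at most k+1 from the king u to w.
module Submission where

open import Defs
open import Data.Nat using (ℕ; zero; suc; _+_; _≤_; _<_; z≤n; s≤s; _≤?_)
open import Data.Nat.Properties using (≤-refl; ≤-trans; ≤-antisym; m≤n⇒m≤1+n; n≤1+n; <⇒≱; ≰⇒>; <-cmp)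
open import Data.Fin using (Fin; inject₁; fromℕ) renaming (zero to fzero; suc to fsuc)
open import Data.Fin.Properties using (_≟_; suc-injective)
open import Data.Product using (Σ; _×_; _,_; ∃; proj₁; proj₂)
open import Data.Sum using (_⊎_; inj₁; inj₂; [_,_])
open import Data.Unit using (⊤; tt)
open import Data.Empty using (⊥; ⊥-elim)
open import Function using (_∘_)
open import Function.Definitions using (Injective)
open import Relation.Binary.Definitions using (tri<; tri≈; tri>)
open import Relation.Binary.PropositionalEquality using (_≡_; _≢_; refl; sym; cong; subst)
open import Relation.Nullary using (¬_; Dec; yes; no)
open import Relation.Nullary.Decidable using (_⊎-dec_)

module Walks (D : Digraph) where

  private
    variable
      a b c x y : Vertex D
      ℓ m r : ℕ

  infixr 5 _∷_
  infixl 4 _∷ʳ_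

  data Walk : Vertex D → Vertex D → ℕ → Set where
    []  : Walk a a 0
    _∷_ : Arc D a b → Walk b c ℓ → Walk a c (suc ℓ)

  _∷ʳ_ : Walk a b ℓ → Arc D b c → Walk a c (suc ℓ)
  [] ∷ʳ e = e ∷ []
  (e′ ∷ W) ∷ʳ e = e′ ∷ (W ∷ʳ e)

  data SnocView : Walk a c (suc ℓ) → Set where
    _∷ʳ′_ : (W : Walk a b ℓ) (e : Arc D b c) → SnocView (W ∷ʳ e)

  snocView : (W : Walk a c (suc ℓ)) → SnocView W
  snocView (e ∷ []) = [] ∷ʳ′ e
  snocView (e ∷ e′ ∷ W) with e′ ∷ W | snocView (e′ ∷ W)
  ... | .(W′ ∷ʳ f) | W′ ∷ʳ′ f = (e ∷ W′) ∷ʳ′ f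

  _∈ʷ_ : Vertex D → Walk a b ℓ → Set
  _∈ʷ_ {a = a} x []      = x ≡ a
  _∈ʷ_ {a = a} x (e ∷ W) = x ≡ a ⊎ x ∈ʷ W

  _∈ʷ?_ : (x : Vertex D) (W : Walk a b ℓ) → Dec (x ∈ʷ W)
  _∈ʷ?_ {a = a} x []      = x ≟ a
  _∈ʷ?_ {a = a} x (e ∷ W) = x ≟ a ⊎-dec x ∈ʷ? W

  source-∈ʷ : (W : Walk a b ℓ) → a ∈ʷ W
  source-∈ʷ []      = refl
  source-∈ʷ (e ∷ W) = inj₁ refl

  target-∈ʷ : (W : Walk a b ℓ) → b ∈ʷ W
  target-∈ʷ []      = refl
  target-∈ʷ (e ∷ W) = inj₂ (target-∈ʷ W)

  ∈ʷ-∷ʳ⁺ : (W : Walk a b ℓ) (e : Arc D b c) → x ∈ʷ W → x ∈ʷ (W ∷ʳ e)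
  ∈ʷ-∷ʳ⁺ []       e refl        = inj₁ refl
  ∈ʷ-∷ʳ⁺ (e′ ∷ W) e (inj₁ refl) = inj₁ refl
  ∈ʷ-∷ʳ⁺ (e′ ∷ W) e (inj₂ x∈W)  = inj₂ (∈ʷ-∷ʳ⁺ W e x∈W)

  ∈ʷ-∷ʳ⁻ : (W : Walk a b ℓ) (e : Arc D b c) → x ∈ʷ (W ∷ʳ e) → x ∈ʷ W ⊎ x ≡ c
  ∈ʷ-∷ʳ⁻ []       e (inj₁ refl) = inj₁ refl
  ∈ʷ-∷ʳ⁻ []       e (inj₂ refl) = inj₂ refl
  ∈ʷ-∷ʳ⁻ (e′ ∷ W) e (inj₁ refl) = inj₁ (inj₁ refl)
  ∈ʷ-∷ʳ⁻ (e′ ∷ W) e (inj₂ x∈)   = [ inj₁ ∘ inj₂ , inj₂ ] (∈ʷ-∷ʳ⁻ W e x∈)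

  IsPath : Walk a b ℓ → Set
  IsPath []                = ⊤
  IsPath {a = a} (e ∷ W) = ¬ a ∈ʷ W × IsPath W

  IsPath-∷ʳ⁺ : (W : Walk a b ℓ) (e : Arc D b c) → IsPath W → ¬ c ∈ʷ W → IsPath (W ∷ʳ e)
  IsPath-∷ʳ⁺ []       e _          c∉ = (λ a≡c → c∉ (sym a≡c)) , tt
  IsPath-∷ʳ⁺ (e′ ∷ W) e (a∉ , pW) c∉ =
    [ a∉ , (λ a≡c → c∉ (inj₁ (sym a≡c))) ] ∘ ∈ʷ-∷ʳ⁻ W e , IsPath-∷ʳ⁺ W e pW (c∉ ∘ inj₂)

  IsPath-∷ʳ⁻ : (W : Walk a b ℓ) (e : Arc D b c) → IsPath (W ∷ʳ e) → IsPath W × ¬ c ∈ʷ W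
  IsPath-∷ʳ⁻ []       e (a∉ , _)  = tt , λ c≡a → a∉ (sym c≡a)
  IsPath-∷ʳ⁻ (e′ ∷ W) e (a∉ , pW) with IsPath-∷ʳ⁻ W e pW
  ... | pW′ , c∉W = (a∉ ∘ ∈ʷ-∷ʳ⁺ W e , pW′)
                  , [ (λ c≡a → a∉ (subst (_∈ʷ (W ∷ʳ e)) c≡a (target-∈ʷ (W ∷ʳ e)))) , c∉W ]

  IsPath-∷-∷ʳ : (e : Arc D a x) (M : Walk x y ℓ) (f : Arc D y c) →
                IsPath M → ¬ a ∈ʷ M → ¬ c ∈ʷ M → a ≢ c → IsPath (e ∷ (M ∷ʳ f))
  IsPath-∷-∷ʳ e M f pM a∉M c∉M a≢c = [ a∉M , a≢c ] ∘ ∈ʷ-∷ʳ⁻ M f , IsPath-∷ʳ⁺ M f pM c∉M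

  record PathWithin (a b : Vertex D) (r : ℕ) : Set where
    constructor pathWithin
    field
      {len}  : ℕ
      len≤   : len ≤ r
      walk   : Walk a b len
      isPath : IsPath walk

  weaken : r ≤ m → PathWithin a b r → PathWithin a b m
  weaken r≤m (pathWithin ℓ≤r P pP) = pathWithin (≤-trans ℓ≤r r≤m) P pP

  suffixFrom : (P : Walk a b ℓ) → IsPath P → x ∈ʷ P → PathWithin x b ℓ
  suffixFrom []       _        refl        = pathWithin z≤n [] tt
  suffixFrom (e ∷ P) pP       (inj₁ refl) = pathWithin ≤-refl (e ∷ P) pP
  suffixFrom (e ∷ P) (_ , pP) (inj₂ x∈P)  = weaken (n≤1+n _) (suffixFrom P pP x∈P)

  shorten : Walk a b ℓ → PathWithin a b ℓ
  shorten []                = pathWithin z≤n [] tt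
  shorten {a = a} (e ∷ W) with shorten W
  ... | pathWithin ℓ≤ P pP with a ∈ʷ? P
  ...   | yes a∈P = weaken (m≤n⇒m≤1+n ℓ≤) (suffixFrom P pP a∈P)
  ...   | no  a∉P = pathWithin (s≤s ℓ≤) (e ∷ P) (a∉P , pP)

  vertexAt : Walk a b ℓ → Fin (suc ℓ) → Vertex D
  vertexAt {a = a} W       fzero    = a
  vertexAt         []      (fsuc ())
  vertexAt         (e ∷ W) (fsuc i) = vertexAt W i

  vertexAt-∈ʷ : (W : Walk a b ℓ) (i : Fin (suc ℓ)) → vertexAt W i ∈ʷ W
  vertexAt-∈ʷ W       fzero    = source-∈ʷ W
  vertexAt-∈ʷ (e ∷ W) (fsuc i) = inj₂ (vertexAt-∈ʷ W i)

  vertexAt-last : (W : Walk a b ℓ) → vertexAt W (fromℕ ℓ) ≡ b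
  vertexAt-last []      = refl
  vertexAt-last (e ∷ W) = vertexAt-last W

  vertexAt-arc : (W : Walk a b ℓ) (i : Fin ℓ) → Arc D (vertexAt W (inject₁ i)) (vertexAt W (fsuc i))
  vertexAt-arc (e ∷ W) fzero    = e
  vertexAt-arc (e ∷ W) (fsuc i) = vertexAt-arc W i

  vertexAt-injective : (W : Walk a b ℓ) → IsPath W → Injective _≡_ _≡_ (vertexAt W)
  vertexAt-injective W        _         {fzero}  {fzero}  _  = refl
  vertexAt-injective (e ∷ W) (a∉ , _)  {fzero}  {fsuc j} eq = ⊥-elim (a∉ (subst (_∈ʷ W) (sym eq) (vertexAt-∈ʷ W j)))
  vertexAt-injective (e ∷ W) (a∉ , _)  {fsuc i} {fzero}  eq = ⊥-elim (a∉ (subst (_∈ʷ W) eq (vertexAt-∈ʷ W i)))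
  vertexAt-injective (e ∷ W) (_ , pW)  {fsuc i} {fsuc j} eq = cong fsuc (vertexAt-injective W pW eq)

  toPath : (W : Walk a b ℓ) → IsPath W → Path D ℓ
  toPath W pW = record
    { vert     = vertexAt W
    ; distinct = vertexAt-injective W pW
    ; arcs     = vertexAt-arc W
    }

  toPathOfLength : (W : Walk a b ℓ) → IsPath W → PathOfLength D a b ℓ
  toPathOfLength W pW = toPath W pW , refl , vertexAt-last W

  dropStart : Path D (suc ℓ) → Path D ℓ
  dropStart p = record
    { vert     = vert p ∘ fsuc
    ; distinct = λ eq → suc-injective (distinct p eq)
    ; arcs     = arcs p ∘ fsuc
    }

  walkAlong : (p : Path D ℓ) → Walk (start p) (end p) ℓ
  walkAlong {zero}  p = []
  walkAlong {suc ℓ} p = arcs p fzero ∷ walkAlong (dropStart p)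

  walkAlong-∈ʷ : (p : Path D ℓ) → x ∈ʷ walkAlong p → ∃ λ i → vert p i ≡ x
  walkAlong-∈ʷ {zero}  p refl        = fzero , refl
  walkAlong-∈ʷ {suc ℓ} p (inj₁ refl) = fzero , refl
  walkAlong-∈ʷ {suc ℓ} p (inj₂ x∈)  with walkAlong-∈ʷ (dropStart p) x∈
  ... | i , eq = fsuc i , eq

  walkAlong-isPath : (p : Path D ℓ) → IsPath (walkAlong p)
  walkAlong-isPath {zero}  p = tt
  walkAlong-isPath {suc ℓ} p = start∉ , walkAlong-isPath (dropStart p)
    where
    start∉ : ¬ start p ∈ʷ walkAlong (dropStart p)
    start∉ s∈ with walkAlong-∈ʷ (dropStart p) s∈
    ... | i , eq with distinct p eq
    ... | ()

  fromPathOfLength : PathOfLength D a b ℓ → Σ (Walk a b ℓ) IsPath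
  fromPathOfLength (p , refl , refl) = walkAlong p , walkAlong-isPath p

  toDistLe : PathWithin a b r → DistLe D a b r
  toDistLe (pathWithin ℓ≤r P pP) = _ , ℓ≤r , toPathOfLength P pP

  fromDistLe : DistLe D a b r → PathWithin a b r
  fromDistLe (_ , ℓ≤r , p) with fromPathOfLength p
  ... | P , pP = pathWithin ℓ≤r P pP

  DistEq⇒≤walk-length : DistEq D a b m → Walk a b ℓ → m ≤ ℓ
  DistEq⇒≤walk-length (_ , minimal) W with shorten W
  ... | pathWithin ℓ′≤ℓ P pP = ≤-trans (minimal _ (toPathOfLength P pP)) ℓ′≤ℓ

  quasiTransitive-path : ∀ {k} → QuasiTransitive k D → (P : Walk a b k) → IsPath P → Arc D a b ⊎ Arc D b a
  quasiTransitive-path {a = a} qt P pP =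
    subst (λ y → Arc D a y ⊎ Arc D y a) (vertexAt-last P) (qt (toPath P pP))

module KingArgument (j : ℕ) (D : Digraph) (qt : QuasiTransitive (2 + j) D)
                    (u : Vertex D) (king : IsKing D (3 + j) u)
                    (v : Vertex D) (u⇝v : DistEq D u v (3 + j)) where

  open Walks D

  private
    variable
      w x y z t : Vertex D
      ℓ m : ℕ

  k : ℕ
  k = 2 + j

  far : Walk u v ℓ → k < ℓ
  far = DistEq⇒≤walk-length u⇝v

  no-walk-of-length-2 : Arc D u x → Arc D x v → ⊥
  no-walk-of-length-2 e f = <⇒≱ (far (e ∷ f ∷ [])) (s≤s (s≤s z≤n))

  arcFromTarget : Arc D u x → (P : Walk x v k) → IsPath P → Arc D v x
  arcFromTarget e P pP =
    [ (λ x→v → ⊥-elim (no-walk-of-length-2 e x→v)) , (λ v→x → v→x) ] (quasiTransitive-path qt P pP)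

  arcToSource : (P : Walk u x k) → Arc D x v → IsPath P → Arc D x u
  arcToSource P f pP =
    [ (λ u→x → ⊥-elim (no-walk-of-length-2 u→x f)) , (λ x→u → x→u) ] (quasiTransitive-path qt P pP)

  walkBack : (X : Walk u v (suc k)) → IsPath X → Walk v u (suc k)
  walkBack (e ∷ X₁) pX with snocView X₁
  ... | M ∷ʳ′ f = arcFromTarget e (M ∷ʳ f) (proj₂ pX)
                ∷ (M ∷ʳ arcToSource (e ∷ M) f (proj₁ (IsPath-∷ʳ⁻ (e ∷ M) f pX)))

  Near : Vertex D → Set
  Near w = PathWithin v w (suc k)

  near : Walk v w ℓ → ℓ ≤ suc k → Near w
  near W ℓ≤ = weaken ℓ≤ (shorten W)

  walkFromTarget : (S : Walk u x k) → IsPath S → ¬ v ∈ʷ S → Arc D x v → Walk v x k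
  walkFromTarget (e ∷ S₁) (_ , pS₁) v∉S f =
    arcFromTarget e (S₁ ∷ʳ f) (IsPath-∷ʳ⁺ S₁ f pS₁ (v∉S ∘ inj₂)) ∷ S₁

  -- As d(u,v) = k+1, the walk u x y v forces k = 2, and then u x y is a path of length k.
  near-of-chord-to-target : (e : Arc D u x) (e′ : Arc D x y) (S₂ : Walk y w (suc j)) →
    IsPath (e ∷ e′ ∷ S₂) → ¬ v ∈ʷ (e ∷ e′ ∷ S₂) → Arc D y v → Near w
  near-of-chord-to-target e e′ (h ∷ []) pS v∉S g =
    near (walkFromTarget (e ∷ e′ ∷ []) (proj₁ (IsPath-∷ʳ⁻ (e ∷ e′ ∷ []) h pS))
                         (v∉S ∘ ∈ʷ-∷ʳ⁺ (e ∷ e′ ∷ []) h) g ∷ʳ h)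
         ≤-refl
  near-of-chord-to-target e e′ (h ∷ h′ ∷ S₄) _ _ g =
    ⊥-elim (<⇒≱ (far (e ∷ e′ ∷ g ∷ [])) (s≤s (s≤s (s≤s z≤n))))

  near-of-long-path : (S : Walk u w (suc k)) → IsPath S → ¬ v ∈ʷ S → Arc D w v → Near w
  near-of-long-path (e ∷ e′ ∷ S₂) pS v∉S f =
    [ near-of-chord-to-target e e′ S₂ pS v∉S , (λ v→y → near (v→y ∷ S₂) (n≤1+n _)) ]
      (quasiTransitive-path qt (S₂ ∷ʳ f) (IsPath-∷ʳ⁺ S₂ f (proj₂ (proj₂ pS)) (v∉S ∘ inj₂ ∘ inj₂)))

  near-of-path-avoiding-target : (S : Walk u w m) → IsPath S → ¬ v ∈ʷ S → Arc D w v → m ≤ suc k → Near w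
  near-of-path-avoiding-target {m = m} S pS v∉S f m≤ with <-cmp m k
  ... | tri< m<k _ _ = ⊥-elim (<⇒≱ (far (S ∷ʳ f)) m<k)
  ... | tri≈ _ refl _ = near (walkFromTarget S pS v∉S f) (n≤1+n _)
  ... | tri> _ _ k<m with ≤-antisym m≤ k<m
  ...   | refl = near-of-long-path S pS v∉S f

  near-of-arc-to-target : Arc D w v → Near w
  near-of-arc-to-target {w} f with fromDistLe (king w)
  ... | pathWithin m≤ S pS with v ∈ʷ? S
  ...   | yes v∈S = weaken m≤ (suffixFrom S pS v∈S)
  ...   | no  v∉S = near-of-path-avoiding-target S pS v∉S f m≤

  near-of-closing-cycle : (w→y : Arc D w y) (M : Walk y z j) (z→v : Arc D z v) →
    IsPath M → ¬ w ∈ʷ M → ¬ v ∈ʷ M → w ≢ v → Near w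
  near-of-closing-cycle w→y M z→v pM w∉M v∉M w≢v =
    [ near-of-arc-to-target , (λ v→w → near (v→w ∷ []) (s≤s z≤n)) ]
      (quasiTransitive-path qt (w→y ∷ (M ∷ʳ z→v)) (IsPath-∷-∷ʳ w→y M z→v pM w∉M v∉M w≢v))

  near-of-split-path-of-length-k+2 : (e₀ : Arc D v x) (e₁ : Arc D x y) (M : Walk y z j) (e₂ : Arc D z t) (e₃ : Arc D t w) →
    IsPath (e₀ ∷ e₁ ∷ (M ∷ʳ e₂ ∷ʳ e₃)) → Near w
  near-of-split-path-of-length-k+2 {w = w} e₀ e₁ M e₂ e₃ pR =
    [ (λ y→w → near (e₀ ∷ e₁ ∷ y→w ∷ []) (s≤s (s≤s (s≤s z≤n))))
    , (λ w→y →
        [ (λ v→z → near (v→z ∷ e₂ ∷ e₃ ∷ []) (s≤s (s≤s (s≤s z≤n))))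
        , (λ z→v → near-of-closing-cycle w→y M z→v (proj₂ (proj₂ pPrefix)) w∉M (proj₁ pPrefix ∘ inj₂) w≢v)
        ] (quasiTransitive-path qt (e₀ ∷ e₁ ∷ M) pPrefix))
    ] (quasiTransitive-path qt (M ∷ʳ e₂ ∷ʳ e₃) (proj₂ (proj₂ pR)))
    where
    w∉prefix : ¬ w ∈ʷ (e₀ ∷ e₁ ∷ M ∷ʳ e₂)
    w∉prefix = proj₂ (IsPath-∷ʳ⁻ (e₀ ∷ e₁ ∷ M ∷ʳ e₂) e₃ pR)
    pPrefix : IsPath (e₀ ∷ e₁ ∷ M)
    pPrefix = proj₁ (IsPath-∷ʳ⁻ (e₀ ∷ e₁ ∷ M) e₂ (proj₁ (IsPath-∷ʳ⁻ (e₀ ∷ e₁ ∷ M ∷ʳ e₂) e₃ pR)))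
    w∉M : ¬ w ∈ʷ M
    w∉M = w∉prefix ∘ ∈ʷ-∷ʳ⁺ (e₀ ∷ e₁ ∷ M) e₂ ∘ inj₂ ∘ inj₂
    w≢v : w ≢ v
    w≢v w≡v = w∉prefix (subst (_∈ʷ (e₀ ∷ e₁ ∷ M ∷ʳ e₂)) (sym w≡v) (inj₁ refl))

  near-of-path-of-length-k+2 : (R : Walk v w (2 + k)) → IsPath R → Near w
  near-of-path-of-length-k+2 (e₀ ∷ e₁ ∷ R₂) pR with snocView R₂
  ... | R₃ ∷ʳ′ e₃ with snocView R₃
  ...   | M ∷ʳ′ e₂ = near-of-split-path-of-length-k+2 e₀ e₁ M e₂ e₃ pR

  near-step : Near x → Arc D x w → Near w
  near-step (pathWithin ℓ≤ P _) f with shorten (P ∷ʳ f)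
  ... | pathWithin {ℓ′} ℓ′≤ R pR with ℓ′ ≤? suc k
  ...   | yes ℓ′≤k+1 = pathWithin ℓ′≤k+1 R pR
  ...   | no  ℓ′≰k+1 with ≤-antisym (≤-trans ℓ′≤ (s≤s ℓ≤)) (≰⇒> ℓ′≰k+1)
  ...     | refl = near-of-path-of-length-k+2 R pR

  near-along : Walk x w ℓ → Near x → Near w
  near-along []      nx = nx
  near-along (f ∷ W) nx = near-along W (near-step nx f)

  target-isKing : IsKing D (suc k) v
  target-isKing w with fromPathOfLength (proj₁ u⇝v) | fromDistLe (king w)
  ... | X , pX | pathWithin _ S _ = toDistLe (near-along S (near (walkBack X pX) ≤-refl))

mainTheorem8 : (k : ℕ) → 2 ≤ k → (D : Digraph) → QuasiTransitive k D →
    (u : Vertex D) → IsKing D (suc k) u →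
    (v : Vertex D) → DistEq D u v (suc k) → IsKing D (suc k) v
mainTheorem8 (suc (suc j)) (s≤s (s≤s z≤n)) D qt u king v u⇝v = KingArgument.target-isKing j D qt u king v u⇝v
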